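{- Let $m$ be odd. For all integers $a_2,a_3,\dots,a_m\ge3$, $R_{C_m}(3,a_2,a_3,\dots,a_m)=3$.
   Context: $C_m\le S_m$ denotes the cyclic group generated by the $m$-cycle $(1\,2\,\cdots\,m)$. An $m$-edge-coloured complete graph is a complete graph with each edge coloured from $[m]=\{1,\dots,m\}$. For $\Gamma\le S_m$, $\pi\in\Gamma$ and a vertex $v$, switching at $v$ with $\pi$ recolours every edge incident with $v$ of colour $i$ to colour $\pi(i)$, leaving other edges unchanged. Two such graphs on the same vertex set are $\Gamma$-switch equivalent if one is obtained from the other by a finite sequence of switches. $K_t^{(i)}$ is a complete graph on $t$ vertices with all edges of colour $i$. $R_\Gamma(a_1,\dots,a_m)$ is the least $n$ such that every $m$-edge-coloured complete graph on $n$ vertices is $\Gamma$-switch equivalent to one containing, for some $i$, a copy of $K_{a_i}^{(i)}$. -}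

module Defs where

open import Data.Nat using (ℕ; zero; suc; _+_; _*_; _<_; _≤_)
import Data.Nat as ℕ
open import Data.Fin using (Fin; zero; suc; toℕ; lower₁; _≟_)
open import Data.Product using (Σ; ∃; _×_; _,_)
open import Relation.Nullary using (¬_; yes; no)
open import Relation.Binary.PropositionalEquality using (_≡_; _≢_)
open import Relation.Binary.Construct.Closure.ReflexiveTransitive using (Star)
open import Function.Definitions using (Injective)

-- Colours [m] = {1,…,m} are represented by Fin m (colour j+1 ↦ index j).
-- The m-cycle (1 2 ⋯ m): i ↦ i+1, and m ↦ 1.
cyc : ∀ {m} → Fin m → Fin m
cyc {suc n} i with n ℕ.≟ toℕ i
... | yes _ = zero
... | no ne = suc (lower₁ i ne)

-- cyc^k ; the group C_m consists exactly of the permutations cycPow k, k ∈ ℕ.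
cycPow : ∀ {m} → ℕ → Fin m → Fin m
cycPow zero    i = i
cycPow (suc k) i = cyc (cycPow k i)

-- An m-edge-coloured complete graph on vertex set Fin n: a colouring of
-- ordered pairs which is symmetric (the diagonal is irrelevant).
Colouring : ℕ → ℕ → Set
Colouring m n = Fin n → Fin n → Fin m

Symmetric : ∀ {m n} → Colouring m n → Set
Symmetric c = ∀ x y → c x y ≡ c y x

switch : ∀ {m n} → ℕ → Fin n → Colouring m n → Colouring m n
switch k v c x y with x ≟ v | y ≟ v
... | yes _ | no _  = cycPow k (c x y)
... | no _  | yes _ = cycPow k (c x y)
... | _     | _     = c x y

SwitchStep : ∀ {m n} → Colouring m n → Colouring m n → Set
SwitchStep c c' = Σ ℕ λ k → Σ _ λ v → c' ≡ switch k v c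

SwitchEquiv : ∀ {m n} → Colouring m n → Colouring m n → Set
SwitchEquiv = Star SwitchStep

ContainsMono : ∀ {m n} → Colouring m n → Fin m → ℕ → Set
ContainsMono {n = n} c i t =
  Σ (Fin t → Fin n) λ f → Injective _≡_ _≡_ f × (∀ x y → x ≢ y → c (f x) (f y) ≡ i)

RamseyProp : (m : ℕ) → (Fin m → ℕ) → ℕ → Set
RamseyProp m a n = (c : Colouring m n) → Symmetric c →
  Σ (Colouring m n) λ c' → SwitchEquiv c c' × Σ (Fin m) λ i → ContainsMono c' i (a i)

RamseyNumberIs : (m : ℕ) → (Fin m → ℕ) → ℕ → Set
RamseyNumberIs m a r = RamseyProp m a r × (∀ n → n < r → ¬ RamseyProp m a n)

module Submission where

open import Defs
open import Data.Nat using (ℕ; zero; suc; _+_; _*_; _%_; _≤_; _<_; s≤s; NonZero)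
import Data.Nat as ℕ
open import Data.Nat.Properties
  using (+-commutativeSemigroup; ≤-pred; ≤∧≢⇒<; ≤-trans; +-suc; +-identityʳ; <⇒≱)
open import Data.Nat.DivMod using (%-distribˡ-+; m%n%n≡m%n; n%n≡0; m<n⇒m%n≡m; m*n%n≡0)
open import Data.Nat.Tactic.RingSolver using (solve-∀)
open import Algebra.Properties.CommutativeSemigroup +-commutativeSemigroup
  using (xy∙z≈xz∙y; xy∙z≈zx∙y; xy∙z≈zy∙x)
open import Data.Fin using (Fin; zero; suc; toℕ)
open import Data.Fin.Properties using (toℕ-injective; toℕ-lower₁; toℕ<n; injective⇒≤)
open import Data.Product using (Σ; _,_; _×_)
open import Data.Empty using (⊥-elim)
open import Relation.Nullary using (¬_; yes; no)
open import Relation.Binary.PropositionalEquality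
  using (_≡_; _≢_; refl; sym; trans; cong; subst; module ≡-Reasoning)
open import Relation.Binary.Construct.Closure.ReflexiveTransitive using (ε; _◅_)

-- Switching the vertices u of a triangle by xᵤ adds xᵤ + xᵥ to the colour of each
-- edge uv (mod m).  As m is odd, 2 is invertible mod m, and the system cᵤᵥ + xᵤ + xᵥ ≡ 0
-- is solved by taking xᵤ to be the colour of the edge opposite u minus half the sum
-- of all three colours.  So every triangle switches to a monochromatic one, while a
-- graph on at most two vertices contains no monochromatic triangle at all.

[m+n%d]%d≡[m+n]%d : ∀ m n d .{{_ : NonZero d}} → (m + n % d) % d ≡ (m + n) % d
[m+n%d]%d≡[m+n]%d m n d = trans (%-distribˡ-+ m (n % d) d)
  (trans (cong (λ t → (m % d + t) % d) (m%n%n≡m%n n d)) (sym (%-distribˡ-+ m n d)))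

toℕ-cyc : ∀ {n} (i : Fin (suc n)) → toℕ (cyc i) ≡ suc (toℕ i) % suc n
toℕ-cyc {n} i with n ℕ.≟ toℕ i
... | yes n≡i rewrite sym n≡i = sym (n%n≡0 (suc n))
... | no n≢i = trans (cong suc (toℕ-lower₁ i n≢i))
  (sym (m<n⇒m%n≡m (s≤s (≤∧≢⇒< (≤-pred (toℕ<n i)) (λ i≡n → n≢i (sym i≡n))))))

toℕ-cycPow : ∀ {n} k (i : Fin (suc n)) → toℕ (cycPow k i) ≡ (toℕ i + k) % suc n
toℕ-cycPow {n} zero i = begin
  toℕ i               ≡⟨ sym (m<n⇒m%n≡m (toℕ<n i)) ⟩
  toℕ i % suc n       ≡⟨ cong (_% suc n) (sym (+-identityʳ (toℕ i))) ⟩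
  (toℕ i + 0) % suc n ∎
  where open ≡-Reasoning
toℕ-cycPow {n} (suc k) i = begin
  toℕ (cyc (cycPow k i))           ≡⟨ toℕ-cyc (cycPow k i) ⟩
  suc (toℕ (cycPow k i)) % suc n   ≡⟨ cong (λ t → suc t % suc n) (toℕ-cycPow k i) ⟩
  suc ((toℕ i + k) % suc n) % suc n ≡⟨ [m+n%d]%d≡[m+n]%d 1 (toℕ i + k) (suc n) ⟩
  suc (toℕ i + k) % suc n          ≡⟨ cong (_% suc n) (sym (+-suc (toℕ i) k)) ⟩
  (toℕ i + suc k) % suc n          ∎
  where open ≡-Reasoning

cycPow-+ : ∀ {m} x y (i : Fin m) → cycPow y (cycPow x i) ≡ cycPow (x + y) i
cycPow-+ x zero    i rewrite +-identityʳ x = refl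
cycPow-+ x (suc y) i rewrite +-suc x y = cong cyc (cycPow-+ x y i)

cycPow-cancel : ∀ {n} x y (i : Fin (suc n)) q →
  toℕ i + (x + y) ≡ q * suc n → cycPow y (cycPow x i) ≡ zero
cycPow-cancel {n} x y i q eq = toℕ-injective (begin
  toℕ (cycPow y (cycPow x i))  ≡⟨ cong toℕ (cycPow-+ x y i) ⟩
  toℕ (cycPow (x + y) i)       ≡⟨ toℕ-cycPow (x + y) i ⟩
  (toℕ i + (x + y)) % suc n    ≡⟨ cong (_% suc n) eq ⟩
  (q * suc n) % suc n          ≡⟨ m*n%n≡0 q (suc n) ⟩
  0                            ∎)
  where open ≡-Reasoning

-- Represents −s/2 modulo 2k+1: twice it is (4k(k+1))·s = ((2k+1)² − 1)·s.
minusHalf : ℕ → ℕ → ℕ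
minusHalf k s = 2 * k * suc k * s

minusHalf-+-minusHalf : ∀ k s →
  s + (minusHalf k s + minusHalf k s) ≡ s * (1 + 2 * k) * (1 + 2 * k)
minusHalf-+-minusHalf k s = expanded k s
  where
  expanded : ∀ k s → s + (2 * k * suc k * s + 2 * k * suc k * s) ≡ s * (1 + 2 * k) * (1 + 2 * k)
  expanded = solve-∀

shifts-cancel : ∀ k {s} e f g → e + f + g ≡ s →
  e + ((f + minusHalf k s) + (g + minusHalf k s)) ≡ s * (1 + 2 * k) * (1 + 2 * k)
shifts-cancel k e f g refl =
  trans (regroup e f g (minusHalf k (e + f + g))) (minusHalf-+-minusHalf k (e + f + g))
  where
  regroup : ∀ e f g h → e + ((f + h) + (g + h)) ≡ e + f + g + (h + h)
  regroup = solve-∀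

triangle-switchable : ∀ k (c : Colouring (1 + 2 * k) 3) → Symmetric c →
  Σ (Colouring (1 + 2 * k) 3) λ c' → SwitchEquiv c c' × ContainsMono c' zero 3
triangle-switchable k c c-sym = c' , steps , (λ v → v) , (λ v≡w → v≡w) , mono
  where
  v₀ v₁ v₂ : Fin 3
  v₀ = zero
  v₁ = suc zero
  v₂ = suc (suc zero)
  c₀₁ = toℕ (c v₀ v₁)
  c₀₂ = toℕ (c v₀ v₂)
  c₁₂ = toℕ (c v₁ v₂)
  s = c₀₁ + c₀₂ + c₁₂
  x₀ = c₁₂ + minusHalf k s
  x₁ = c₀₂ + minusHalf k s
  x₂ = c₀₁ + minusHalf k s
  c' = switch x₂ v₂ (switch x₁ v₁ (switch x₀ v₀ c))
  steps : SwitchEquiv c c'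
  steps = (x₀ , v₀ , refl) ◅ (x₁ , v₁ , refl) ◅ (x₂ , v₂ , refl) ◅ ε
  q = s * (1 + 2 * k)
  -- For u < v, c' u v computes to cycPow xᵥ (cycPow xᵤ (c u v)).
  e₀₁ : cycPow x₁ (cycPow x₀ (c v₀ v₁)) ≡ zero
  e₀₁ = cycPow-cancel x₀ x₁ (c v₀ v₁) q (shifts-cancel k c₀₁ c₁₂ c₀₂ (xy∙z≈xz∙y c₀₁ c₁₂ c₀₂))
  e₀₂ : cycPow x₂ (cycPow x₀ (c v₀ v₂)) ≡ zero
  e₀₂ = cycPow-cancel x₀ x₂ (c v₀ v₂) q (shifts-cancel k c₀₂ c₁₂ c₀₁ (xy∙z≈zx∙y c₀₂ c₁₂ c₀₁))
  e₁₂ : cycPow x₂ (cycPow x₁ (c v₁ v₂)) ≡ zero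
  e₁₂ = cycPow-cancel x₁ x₂ (c v₁ v₂) q (shifts-cancel k c₁₂ c₀₂ c₀₁ (xy∙z≈zy∙x c₁₂ c₀₂ c₀₁))
  mono : ∀ u v → u ≢ v → c' u v ≡ zero
  mono zero             zero             u≢v = ⊥-elim (u≢v refl)
  mono zero             (suc zero)       _   = e₀₁
  mono zero             (suc (suc zero)) _   = e₀₂
  mono (suc zero)       zero             _   rewrite c-sym v₁ v₀ = e₀₁
  mono (suc zero)       (suc zero)       u≢v = ⊥-elim (u≢v refl)
  mono (suc zero)       (suc (suc zero)) _   = e₁₂
  mono (suc (suc zero)) zero             _   rewrite c-sym v₂ v₀ = e₀₂
  mono (suc (suc zero)) (suc zero)       _   rewrite c-sym v₂ v₁ = e₁₂
  mono (suc (suc zero)) (suc (suc zero)) u≢v = ⊥-elim (u≢v refl)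

ContainsMono⇒≤ : ∀ {m n} {c : Colouring m n} {i t} → ContainsMono c i t → t ≤ n
ContainsMono⇒≤ (_ , f-injective , _) = injective⇒≤ f-injective

RamseyProp⇒≤ : ∀ {m n t} (a : Fin (suc m) → ℕ) → (∀ i → t ≤ a i) → RamseyProp (suc m) a n → t ≤ n
RamseyProp⇒≤ a t≤a ramsey with ramsey (λ _ _ → zero) (λ _ _ → refl)
... | c' , _ , i , mono = ≤-trans (t≤a i) (ContainsMono⇒≤ {c = c'} mono)

corollary23 : (m k : ℕ) → m ≡ 1 + 2 * k → (a : Fin m → ℕ) →
    (∀ i → toℕ i ≡ 0 → a i ≡ 3) → (∀ i → 3 ≤ a i) →
    RamseyNumberIs m a 3
corollary23 .(1 + 2 * k) k refl a a₀≡3 3≤a = upper , lower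
  where
  upper : RamseyProp (1 + 2 * k) a 3
  upper c c-sym with triangle-switchable k c c-sym
  ... | c' , c↝c' , mono = c' , c↝c' , zero , subst (ContainsMono c' zero) (sym (a₀≡3 zero refl)) mono
  lower : ∀ n → n < 3 → ¬ RamseyProp (1 + 2 * k) a n
  lower n n<3 ramsey = <⇒≱ n<3 (RamseyProp⇒≤ a 3≤a ramsey)
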